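{- Work in ZF. Let $\alpha$ be an ordinal and $x\in W_\alpha$. Suppose $a$ is such that $a\,\widehat\in\,x$, or $a\,\widehat\pi_1\,x$, or $a\,\widehat\pi_2\,x$. Then $a\in W_\beta$ for some ordinal $\beta<\alpha$; in particular $a\in W_\gamma$ for some ordinal $\gamma$.
   Context: $\langle a,b\rangle:=\{\{a\},\{a,b\}\}$ is the Kuratowski ordered pair, $A\times B:=\{\langle c,d\rangle: c\in A,d\in B\}$, $0=\emptyset$, $1=\{0\}$. For ordinals, $W_0=\emptyset$; $W_{\beta+1}=(\{0\}\times\mathcal P(W_\beta))\cup(\{1\}\times(W_\beta\times W_\beta))$; $W_\lambda=\bigcup_{\beta<\lambda}W_\beta$ for limit $\lambda$. Relations: $a\,\widehat\in\,x$ iff $\exists y:(x=\langle 0,y\rangle\wedge a\in y)$; $a\,\widehat\pi_1\,p$ iff $\exists u,v:(p=\langle 1,\langle u,v\rangle\rangle\wedge a=u)$; $a\,\widehat\pi_2\,p$ iff $\exists u,v:(p=\langle 1,\langle u,v\rangle\rangle\wedge a=v)$. -}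

module Defs where

open import Data.Product using (Σ; ∃; ∃-syntax; _×_; _,_)
open import Data.Sum using (_⊎_)
open import Data.Empty using (⊥)
open import Relation.Nullary using (¬_)
open import Relation.Binary.PropositionalEquality using (_≡_)

-- A structure for (the fragment of) ZF set theory used by the statement:
-- a universe U of sets with membership, extensionality, an empty set,
-- unordered pairs, and Foundation in the form of ∈-induction
-- (for arbitrary predicates, i.e. the Foundation/∈-induction schema).
record ZF : Set₁ where
  field
    U     : Set
    _∈_   : U → U → Set
    ext   : ∀ {x y} → (∀ z → z ∈ x → z ∈ y) → (∀ z → z ∈ y → z ∈ x) → x ≡ y
    ∅     : U
    ∅-empty : ∀ z → ¬ (z ∈ ∅)
    upair : U → U → U
    upair-∈ : ∀ a b z → z ∈ upair a b → (z ≡ a) ⊎ (z ≡ b)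
    ∈-upair₁ : ∀ a b → a ∈ upair a b
    ∈-upair₂ : ∀ a b → b ∈ upair a b
    ∈-ind : (P : U → Set) → (∀ x → (∀ y → y ∈ x → P y) → P x) → ∀ x → P x

module _ (M : ZF) where
  open ZF M

  ⟨_,_⟩ : U → U → U
  ⟨ a , b ⟩ = upair (upair a a) (upair a b)

  𝟘 : U
  𝟘 = ∅

  𝟙 : U
  𝟙 = upair ∅ ∅

  Transitive : U → Set
  Transitive x = ∀ y z → z ∈ y → y ∈ x → z ∈ x

  -- von Neumann ordinal: transitive set, linearly (strictly) ordered by ∈
  -- (well-foundedness of ∈ is provided by Foundation, ∈-ind).
  IsOrdinal : U → Set
  IsOrdinal α = Transitive α × (∀ β γ → β ∈ α → γ ∈ α → (β ∈ γ) ⊎ (β ≡ γ) ⊎ (γ ∈ β))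

  IsEmpty : U → Set
  IsEmpty x = ∀ z → ¬ (z ∈ x)

  IsSuccOf : U → U → Set
  IsSuccOf α β = ∀ z → (z ∈ α → (z ∈ β) ⊎ (z ≡ β)) × ((z ∈ β) ⊎ (z ≡ β) → z ∈ α)

  IsLimit : U → Set
  IsLimit α = ¬ IsEmpty α × (∀ β → ¬ IsSuccOf α β)

  _⊆_ : U → U → Set
  x ⊆ y = ∀ z → z ∈ x → z ∈ y

  -- z ∈ ({0} × P(A)) ∪ ({1} × (A × A)), written out
  InWStep : U → U → Set
  InWStep A z = (∃[ y ] (z ≡ ⟨ 𝟘 , y ⟩ × y ⊆ A))
              ⊎ (∃[ u ] ∃[ v ] (z ≡ ⟨ 𝟙 , ⟨ u , v ⟩ ⟩ × u ∈ A × v ∈ A))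

  record IsWHierarchy (W : U → U) : Set where
    field
      W-zero : ∀ α → IsOrdinal α → IsEmpty α → IsEmpty (W α)
      W-succ : ∀ α β → IsOrdinal β → IsSuccOf α β →
               ∀ z → (z ∈ W α → InWStep (W β) z) × (InWStep (W β) z → z ∈ W α)
      W-lim  : ∀ α → IsOrdinal α → IsLimit α →
               ∀ z → (z ∈ W α → ∃[ β ] (β ∈ α × z ∈ W β))
                   × (∃[ β ] (β ∈ α × z ∈ W β) → z ∈ W α)

  _∈̂_ : U → U → Set
  a ∈̂ x = ∃[ y ] (x ≡ ⟨ 𝟘 , y ⟩ × a ∈ y)

  _π̂₁_ : U → U → Set
  a π̂₁ p = ∃[ u ] ∃[ v ] (p ≡ ⟨ 𝟙 , ⟨ u , v ⟩ ⟩ × a ≡ u)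

  _π̂₂_ : U → U → Set
  a π̂₂ p = ∃[ u ] ∃[ v ] (p ≡ ⟨ 𝟙 , ⟨ u , v ⟩ ⟩ × a ≡ v)

module Submission where

-- Elements of W α are codes ⟨0,y⟩ (with y ⊆ W β) or
-- ⟨1,⟨u,v⟩⟩ (with u, v ∈ W β) produced at some successor stage β+1 ≤ α,
-- and the relations ∈̂, π̂₁, π̂₂ read off exactly y's members, u and v.
-- So we argue by ∈-induction on the ordinal α, splitting (classically)
-- into the zero, successor and limit cases:
--   * zero: W α is empty, nothing to prove;
--   * α = β+1: x is built from W β, so a ∈ W β by injectivity of the
--     Kuratowski pair and 0 ≠ 1 (lemma `component-of-step`);
--   * limit: x ∈ W β for some β ∈ α, and the induction hypothesis at β
--     gives γ ∈ β, hence γ ∈ α by transitivity of α.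

open import Defs
open import Data.Product using (∃-syntax; _×_; _,_; proj₁; proj₂)
open import Data.Sum using (_⊎_; inj₁; inj₂; [_,_])
open import Data.Empty using (⊥-elim)
open import Function using (id)
open import Axiom.ExcludedMiddle using (ExcludedMiddle)
open import Level using (0ℓ)
open import Relation.Nullary using (¬_; yes; no)
open import Relation.Binary.PropositionalEquality using (_≡_; refl; sym; trans; subst)

module Basics (M : ZF) where
  open ZF M

  ∈-singleton : ∀ {a z} → z ∈ upair a a → z ≡ a
  ∈-singleton {a} {z} z∈ = [ id , id ] (upair-∈ a a z z∈)

  pair≡singleton : ∀ {a b c} → upair a b ≡ upair c c → a ≡ c × b ≡ c
  pair≡singleton {a} {b} e =
    ∈-singleton (subst (a ∈_) e (∈-upair₁ a b)) ,
    ∈-singleton (subst (b ∈_) e (∈-upair₂ a b))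

  -- First components of equal Kuratowski pairs agree: {a} ∈ ⟨c,d⟩.
  ⟨⟩-injective₁ : ∀ {a b c d} → ⟨_,_⟩ M a b ≡ ⟨_,_⟩ M c d → a ≡ c
  ⟨⟩-injective₁ {a} {b} e
    with upair-∈ _ _ _ (subst (upair a a ∈_) e (∈-upair₁ (upair a a) (upair a b)))
  ... | inj₁ [a]≡[c]   = proj₁ (pair≡singleton [a]≡[c])
  ... | inj₂ [a]≡[c,d] = sym (proj₁ (pair≡singleton (sym [a]≡[c,d])))

  -- Second components of equal pairs with equal first components agree:
  -- compare {a,b} ∈ ⟨a,d⟩ and {a,d} ∈ ⟨a,b⟩.
  ⟨⟩-injective₂ : ∀ {a b d} → ⟨_,_⟩ M a b ≡ ⟨_,_⟩ M a d → b ≡ d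
  ⟨⟩-injective₂ {a} {b} {d} e
    with upair-∈ _ _ _ (subst (upair a b ∈_) e (∈-upair₂ (upair a a) (upair a b)))
  ... | inj₁ [a,b]≡[a] = trans (proj₂ (pair≡singleton [a,b]≡[a]))
                               (sym (proj₂ (pair≡singleton [a,d]≡[a])))
    where
      -- {a,d} ∈ ⟨a,b⟩ = {{a},{a,b}} and {a,b} = {a}
      [a,d]≡[a] : upair a d ≡ upair a a
      [a,d]≡[a] = [ id , (λ q → trans q [a,b]≡[a]) ]
        (upair-∈ _ _ _ (subst (upair a d ∈_) (sym e) (∈-upair₂ (upair a a) (upair a d))))
  ... | inj₂ [a,b]≡[a,d] with upair-∈ a d b (subst (b ∈_) [a,b]≡[a,d] (∈-upair₂ a b))
  ...   | inj₂ b≡d = b≡d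
  ...   | inj₁ b≡a = [ (λ d≡a → trans b≡a (sym d≡a)) , sym ]
      (upair-∈ a b d (subst (d ∈_) (sym [a,b]≡[a,d]) (∈-upair₂ a d)))

  ⟨⟩-injective : ∀ {a b c d} → ⟨_,_⟩ M a b ≡ ⟨_,_⟩ M c d → a ≡ c × b ≡ d
  ⟨⟩-injective e with ⟨⟩-injective₁ e
  ... | refl = refl , ⟨⟩-injective₂ e

  -- The two tags differ: 0 = ∅ while 1 = {∅} is inhabited.
  𝟘≢𝟙 : ¬ (𝟘 M ≡ 𝟙 M)
  𝟘≢𝟙 e = ∅-empty ∅ (subst (∅ ∈_) (sym e) (∈-upair₁ ∅ ∅))

  no-∈-2-cycle : ∀ x y → y ∈ x → ¬ (x ∈ y)
  no-∈-2-cycle = ∈-ind (λ x → ∀ y → y ∈ x → ¬ (x ∈ y))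
    (λ x ih y y∈x x∈y → ih y y∈x x x∈y y∈x)

  no-∈-3-cycle : ∀ x y z → y ∈ x → z ∈ y → ¬ (x ∈ z)
  no-∈-3-cycle = ∈-ind (λ x → ∀ y z → y ∈ x → z ∈ y → ¬ (x ∈ z))
    (λ x ih y z y∈x z∈y x∈z → ih y y∈x z x z∈y x∈z y∈x)

  -- Elements of ordinals are ordinals.  Linearity is inherited from α;
  -- for transitivity of β, comparing z ∈ y ∈ β with β leaves only z ∈ β,
  -- the other cases being ∈-cycles.
  ordinal-elem : ∀ α β → IsOrdinal M α → β ∈ α → IsOrdinal M β
  ordinal-elem α β (trans-α , linear-α) β∈α = trans-β , linear-β
    where
      linear-β : ∀ γ δ → γ ∈ β → δ ∈ β → (γ ∈ δ) ⊎ (γ ≡ δ) ⊎ (δ ∈ γ)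
      linear-β γ δ γ∈β δ∈β =
        linear-α γ δ (trans-α β γ γ∈β β∈α) (trans-α β δ δ∈β β∈α)

      trans-β : Transitive M β
      trans-β y z z∈y y∈β
        with linear-α z β (trans-α y z z∈y (trans-α β y y∈β β∈α)) β∈α
      ... | inj₁ z∈β        = z∈β
      ... | inj₂ (inj₁ refl) = ⊥-elim (no-∈-2-cycle z y y∈β z∈y)
      ... | inj₂ (inj₂ β∈z) = ⊥-elim (no-∈-3-cycle β y z y∈β z∈y β∈z)

  trichotomy : ExcludedMiddle 0ℓ → ∀ α →
               IsEmpty M α ⊎ (∃[ β ] IsSuccOf M α β) ⊎ IsLimit M α
  trichotomy lem α with lem {IsEmpty M α}
  ... | yes empty = inj₁ empty
  ... | no nonempty with lem {∃[ β ] IsSuccOf M α β}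
  ...   | yes succ = inj₂ (inj₁ succ)
  ...   | no nonsucc = inj₂ (inj₂ (nonempty , λ β s → nonsucc (β , s)))

module Hierarchy (M : ZF) where
  open ZF M
  open Basics M

  Component : U → U → Set
  Component a x = _∈̂_ M a x ⊎ _π̂₁_ M a x ⊎ _π̂₂_ M a x

  -- Components of a code built in one step from A lie in A.  The tag
  -- (0 or 1) of x is determined, so the mismatched cases are impossible.
  component-of-step : ∀ {A x a} → InWStep M A x → Component a x → a ∈ A
  component-of-step (inj₁ (y , refl , y⊆A)) (inj₁ (y′ , e , a∈y′))
    with ⟨⟩-injective e
  ... | _ , refl = y⊆A _ a∈y′
  component-of-step (inj₁ (y , refl , _)) (inj₂ (inj₁ (_ , _ , e , _))) =
    ⊥-elim (𝟘≢𝟙 (proj₁ (⟨⟩-injective e)))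
  component-of-step (inj₁ (y , refl , _)) (inj₂ (inj₂ (_ , _ , e , _))) =
    ⊥-elim (𝟘≢𝟙 (proj₁ (⟨⟩-injective e)))
  component-of-step (inj₂ (_ , _ , refl , _ , _)) (inj₁ (_ , e , _)) =
    ⊥-elim (𝟘≢𝟙 (sym (proj₁ (⟨⟩-injective e))))
  component-of-step (inj₂ (u , v , refl , u∈A , _)) (inj₂ (inj₁ (_ , _ , e , refl)))
    with ⟨⟩-injective (proj₂ (⟨⟩-injective e))
  ... | refl , _ = u∈A
  component-of-step (inj₂ (u , v , refl , _ , v∈A)) (inj₂ (inj₂ (_ , _ , e , refl)))
    with ⟨⟩-injective (proj₂ (⟨⟩-injective e))
  ... | _ , refl = v∈A

lemma5 : ExcludedMiddle 0ℓ → (M : ZF) → (W : ZF.U M → ZF.U M) → IsWHierarchy M W →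
    ∀ α x a → IsOrdinal M α → ZF._∈_ M x (W α) →
    (_∈̂_ M a x ⊎ _π̂₁_ M a x ⊎ _π̂₂_ M a x) →
    ∃[ β ] (IsOrdinal M β × ZF._∈_ M β α × ZF._∈_ M a (W β))
lemma5 lem M W W-hier = ∈-ind Claim step
  where
    open ZF M
    open Basics M
    open Hierarchy M
    open IsWHierarchy W-hier

    Claim : U → Set
    Claim α = ∀ x a → IsOrdinal M α → x ∈ W α → Component a x →
              ∃[ β ] (IsOrdinal M β × β ∈ α × a ∈ W β)

    step : ∀ α → (∀ β → β ∈ α → Claim β) → Claim α
    step α ih x a ord-α x∈Wα a◁x with trichotomy lem α
    ... | inj₁ empty = ⊥-elim (W-zero α ord-α empty x x∈Wα)
    ... | inj₂ (inj₁ (β , α=β+1)) =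
      β , ord-β , β∈α , component-of-step (proj₁ (W-succ α β ord-β α=β+1 x) x∈Wα) a◁x
      where
        β∈α = proj₂ (α=β+1 β) (inj₂ refl)
        ord-β = ordinal-elem α β ord-α β∈α
    ... | inj₂ (inj₂ limit) with proj₁ (W-lim α ord-α limit x) x∈Wα
    ...   | β , β∈α , x∈Wβ with ih β β∈α x a (ordinal-elem α β ord-α β∈α) x∈Wβ a◁x
    ...     | γ , ord-γ , γ∈β , a∈Wγ = γ , ord-γ , proj₁ ord-α β γ γ∈β β∈α , a∈Wγ
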